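{- Let $N$ be a positive integer and $\Gamma=\Gamma_0(N,3)$. The $\Gamma$-orbits of lines in $\mathbb{Q}^3$ are in bijection with the positive divisors of $N$: every line is in the $\Gamma$-orbit of the line spanned by ${}^t(1,d,0)$ for exactly one positive divisor $d$ of $N$.
   Context: $\Gamma_0(N,3)$ is the group of matrices in $\mathrm{SL}_3(\mathbb{Z})$ whose $(2,1)$ and $(3,1)$ entries are divisible by $N$. -}

module Defs where

open import Data.Nat as ℕ using (ℕ)
open import Data.Integer as ℤ using (ℤ; +_)
open import Data.Integer.Divisibility as ℤD using ()
open import Data.Rational as ℚ using (ℚ; 0ℚ; 1ℚ)
open import Data.Fin using (Fin; zero; suc)
open import Data.Product using (Σ; _×_; ∃)
open import Relation.Binary.PropositionalEquality using (_≡_; _≢_)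
open import Relation.Nullary using (¬_)

Mat3ℤ : Set
Mat3ℤ = Fin 3 → Fin 3 → ℤ

Vec3ℚ : Set
Vec3ℚ = Fin 3 → ℚ

i0 i1 i2 : Fin 3
i0 = zero
i1 = suc zero
i2 = suc (suc zero)

det3 : Mat3ℤ → ℤ
det3 M =
  (M i0 i0 ℤ.* ((M i1 i1 ℤ.* M i2 i2) ℤ.- (M i1 i2 ℤ.* M i2 i1)))
  ℤ.- (M i0 i1 ℤ.* ((M i1 i0 ℤ.* M i2 i2) ℤ.- (M i1 i2 ℤ.* M i2 i0)))
  ℤ.+ (M i0 i2 ℤ.* ((M i1 i0 ℤ.* M i2 i1) ℤ.- (M i1 i1 ℤ.* M i2 i0)))

InΓ₀ : ℕ → Mat3ℤ → Set
InΓ₀ N M = (det3 M ≡ + 1) × ((+ N) ℤD.∣ M i1 i0) × ((+ N) ℤD.∣ M i2 i0)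

ι : ℤ → ℚ
ι z = z ℚ./ 1

act : Mat3ℤ → Vec3ℚ → Vec3ℚ
act M v i = ((ι (M i i0) ℚ.* v i0) ℚ.+ (ι (M i i1) ℚ.* v i1)) ℚ.+ (ι (M i i2) ℚ.* v i2)

NonZeroVec : Vec3ℚ → Set
NonZeroVec v = ¬ (∀ i → v i ≡ 0ℚ)

SameLine : Vec3ℚ → Vec3ℚ → Set
SameLine v w = Σ ℚ λ c → (c ≢ 0ℚ) × (∀ i → w i ≡ c ℚ.* v i)

e1d0 : ℕ → Vec3ℚ
e1d0 d zero = 1ℚ
e1d0 d (suc zero) = ι (+ d)
e1d0 d (suc (suc zero)) = 0ℚ

InOrbit : ℕ → Vec3ℚ → ℕ → Set
InOrbit N v d = Σ Mat3ℤ λ γ → InΓ₀ N γ × SameLine (act γ v) (e1d0 d)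

-- Clearing denominators, it suffices to classify nonzero x ∈ ℤ³ up to Γ₀(N) and nonzero scalars.
-- Elementary matrices in Γ₀(N) replace (x₁, x₂) by (gcd(x₁, x₂), 0) and add N x₀ to x₂, which
-- brings x to (x₀, k, 0) with k = gcd(x₁, x₂, N x₀). Writing x₀ = g a and k = g d with a, d
-- coprime gives d ∣ N, and a last matrix with first row (u, q), where u a + q d = 1 and u is
-- prime to N, takes (g a, g d, 0) to g ᵗ(1, d, 0). Conversely, for B ∈ Γ₀(N) the second entry of
-- B ᵗ(1, d, 0) is divisible by d, because d ∣ N ∣ B₁₀; so if s ᵗ(1, d, 0) and s′ ᵗ(1, d′, 0) lie
-- in one orbit then d divides d′ times a unit, and by symmetry d = d′.

module Submission where

open import Defs
open import Data.Nat using (ℕ; _<_)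
open import Data.Nat.Divisibility using (_∣_)
open import Data.Product using (Σ; _×_)
open import Relation.Binary.PropositionalEquality using (_≡_)

open import Data.Empty using (⊥-elim)
open import Data.Fin using (Fin; zero; suc)
open import Data.Product using (_,_)
open import Function using (_∘_)
open import Relation.Binary.PropositionalEquality
  using (refl; sym; trans; cong; cong₂; subst; subst₂; _≢_; module ≡-Reasoning)
open import Relation.Nullary using (¬_; yes; no)

import Data.Nat as ℕ
import Data.Nat.Properties as ℕ
import Data.Nat.Divisibility as ℕ
import Data.Nat.GCD as ℕ
import Data.Nat.Coprimality as ℕ
open import Data.Nat.DivMod using (_/_; m/n*n≡m)
open import Data.Nat.Induction using (<-rec)
open import Data.Integer
  using (ℤ; +_; +0; -[1+_]; +[1+_]; 0ℤ; 1ℤ; -1ℤ; _+_; _*_; -_; _-_; _^_; ∣_∣)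
import Data.Integer as ℤ
import Data.Integer.Properties as ℤ
open import Data.Integer.Divisibility.Signed as ℤ∣
  using (divides; ∣ᵤ⇒∣; ∣⇒∣ᵤ) renaming (_∣_ to _∣ℤ_)
open import Data.Integer.Tactic.RingSolver using (solve-∀)
import Data.Rational as ℚ
import Data.Rational.Properties as ℚ
open import Data.Rational.Solver using (module +-*-Solver)
open import Data.Rational using (ℚ; 0ℚ; 1ℚ; ↥_; ↧_; mkℚ; toℚᵘ)
import Data.Rational.Unnormalised as ℚᵘ
import Data.Rational.Unnormalised.Properties as ℚᵘ
open import Data.Rational.Unnormalised using (mkℚᵘ) renaming (_≃_ to _≃ᵘ_)

-- Unimodular pairs of integers

Unimodular : ℤ → ℤ → Set
Unimodular a b = Σ ℤ λ x → Σ ℤ λ y → x * a + y * b ≡ 1ℤ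

unimodular-sym : ∀ {a b} → Unimodular a b → Unimodular b a
unimodular-sym {a} {b} (x , y , e) = y , x , trans (ℤ.+-comm (y * b) (x * a)) e

unimodular-*ʳ : ∀ {a b c} → Unimodular a b → Unimodular a c → Unimodular a (b * c)
unimodular-*ʳ {a} {b} {c} (x₁ , y₁ , e₁) (x₂ , y₂ , e₂) =
  x₁ * x₂ * a + x₁ * y₂ * c + y₁ * b * x₂ , y₁ * y₂ ,
  trans (expand x₁ y₁ x₂ y₂ a b c) (cong₂ _*_ e₁ e₂)
  where
  expand : ∀ x₁ y₁ x₂ y₂ a b c →
    (x₁ * x₂ * a + x₁ * y₂ * c + y₁ * b * x₂) * a + (y₁ * y₂) * (b * c)
      ≡ (x₁ * a + y₁ * b) * (x₂ * a + y₂ * c)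
  expand = solve-∀

unimodular-^ʳ : ∀ {a b} → Unimodular a b → ∀ k → Unimodular a (b ^ k)
unimodular-^ʳ u ℕ.zero    = 0ℤ , 1ℤ , refl
unimodular-^ʳ u (ℕ.suc k) = unimodular-*ʳ u (unimodular-^ʳ u k)

unimodular-∣ʳ : ∀ {a b r} → Unimodular a b → r ∣ℤ b → Unimodular a r
unimodular-∣ʳ {a} {b} {r} (x , y , e) (divides q b≡qr) =
  x , y * q , trans (cong (λ t → x * a + t) (trans (ℤ.*-assoc y q r) (cong (y *_) (sym b≡qr)))) e

unimodular-+* : ∀ {a b} t → Unimodular a b → Unimodular (a + t * b) b
unimodular-+* {a} {b} t (x , y , e) = x , y - x * t , trans (shift x y a b t) e
  where
  shift : ∀ x y a b t → x * (a + t * b) + (y - x * t) * b ≡ x * a + y * b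
  shift = solve-∀

unimodular-divisor : ∀ {a b} c → Unimodular a b → b ∣ℤ c * a → b ∣ℤ c
unimodular-divisor {a} {b} c (x , y , e) b∣ca =
  subst (b ∣ℤ_) c≡ (ℤ∣.∣m∣n⇒∣m+n (ℤ∣.∣n⇒∣m*n x b∣ca) (ℤ∣.∣n⇒∣m*n (c * y) ℤ∣.∣-refl))
  where
  open ≡-Reasoning
  factor : ∀ c x y a b → x * (c * a) + c * y * b ≡ c * (x * a + y * b)
  factor = solve-∀
  c≡ : x * (c * a) + c * y * b ≡ c
  c≡ = begin
    x * (c * a) + c * y * b ≡⟨ factor c x y a b ⟩
    c * (x * a + y * b)     ≡⟨ cong (c *_) e ⟩
    c * 1ℤ                  ≡⟨ ℤ.*-identityʳ c ⟩
    c                       ∎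

identity⇒unimodular : ∀ {m n} → ℕ.Bézout.Identity 1 m n → Unimodular (+ m) (+ n)
identity⇒unimodular {m} {n} (ℕ.Bézout.+- x y eq) = + x , - + y , (begin
  + x * + m + - + y * + n     ≡⟨ cong (λ t → t + - + y * + n) (sym (ℤ.pos-* x m)) ⟩
  + (x ℕ.* m) + - + y * + n   ≡⟨ cong (λ t → + t + - + y * + n) (sym eq) ⟩
  + (1 ℕ.+ y ℕ.* n) + - + y * + n ≡⟨ cong (λ t → 1ℤ + t + - + y * + n) (ℤ.pos-* y n) ⟩
  1ℤ + + y * + n + - + y * + n ≡⟨ cancel (+ y) (+ n) ⟩
  1ℤ                          ∎)
  where
  open ≡-Reasoning
  cancel : ∀ y n → 1ℤ + y * n + - y * n ≡ 1ℤ
  cancel = solve-∀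
identity⇒unimodular (ℕ.Bézout.-+ x y eq) =
  unimodular-sym (identity⇒unimodular (ℕ.Bézout.+- y x eq))

ℕ-gcdFactorisation : ∀ m n → Σ ℕ λ g → Σ ℕ λ b → Σ ℕ λ c →
  m ≡ b ℕ.* g × n ≡ c ℕ.* g × Unimodular (+ b) (+ c)
ℕ-gcdFactorisation m n with ℕ.gcd m n ℕ.≟ 0
... | yes g≡0 =
  0 , 1 , 0 , ℕ.gcd[m,n]≡0⇒m≡0 g≡0 , ℕ.gcd[m,n]≡0⇒n≡0 m g≡0 , 1ℤ , 0ℤ , refl
... | no g≢0 =
  ℕ.gcd m n , m / ℕ.gcd m n , n / ℕ.gcd m n ,
  sym (m/n*n≡m (ℕ.gcd[m,n]∣m m n)) , sym (m/n*n≡m (ℕ.gcd[m,n]∣n m n)) ,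
  identity⇒unimodular (ℕ.coprime-Bézout (ℕ.coprime-/gcd m n))
  where instance _ = ℕ.≢-nonZero g≢0

unimodular-unitˡ : ∀ {u b c} → u * u ≡ 1ℤ → Unimodular b c → Unimodular (u * b) c
unimodular-unitˡ {u} {b} {c} u²≡1 (x , y , e) = x * u , y , (begin
  x * u * (u * b) + y * c   ≡⟨ regroup x u b y c ⟩
  u * u * (x * b) + y * c   ≡⟨ cong (λ t → t * (x * b) + y * c) u²≡1 ⟩
  1ℤ * (x * b) + y * c      ≡⟨ cong (λ t → t + y * c) (ℤ.*-identityˡ (x * b)) ⟩
  x * b + y * c             ≡⟨ e ⟩
  1ℤ                        ∎)
  where
  open ≡-Reasoning
  regroup : ∀ x u b y c → x * u * (u * b) + y * c ≡ u * u * (x * b) + y * c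
  regroup = solve-∀

sign-unit : ∀ x → Σ ℤ λ s → s * s ≡ 1ℤ × x ≡ s * + ∣ x ∣
sign-unit (+ n)    = 1ℤ , refl , sym (ℤ.*-identityˡ (+ n))
sign-unit -[1+ n ] = -1ℤ , refl , sym (ℤ.-1*i≡-i (+ ℕ.suc n))

GcdFactorisation : ℤ → ℤ → Set
GcdFactorisation x y = Σ ℤ λ h → Σ ℤ λ b → Σ ℕ λ c → x ≡ h * b × y ≡ h * + c × Unimodular b (+ c)

gcdFactorisation : ∀ x y → GcdFactorisation x y
gcdFactorisation x y
  with ℕ-gcdFactorisation ∣ x ∣ ∣ y ∣ | sign-unit x | sign-unit y
... | g , m , n , ∣x∣≡mg , ∣y∣≡ng , uni | s , s²≡1 , x≡s∣x∣ | t , t²≡1 , y≡t∣y∣ =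
  t * + g , t * (s * + m) , n , x≡ , y≡ ,
  unimodular-unitˡ {t} t²≡1 (unimodular-unitˡ {s} s²≡1 uni)
  where
  open ≡-Reasoning
  x≡ : x ≡ t * + g * (t * (s * + m))
  x≡ = begin
    x                            ≡⟨ x≡s∣x∣ ⟩
    s * + ∣ x ∣                  ≡⟨ cong (λ k → s * + k) ∣x∣≡mg ⟩
    s * + (m ℕ.* g)              ≡⟨ cong (s *_) (ℤ.pos-* m g) ⟩
    s * (+ m * + g)              ≡⟨ sym (ℤ.*-identityˡ _) ⟩
    1ℤ * (s * (+ m * + g))       ≡⟨ cong (λ u → u * (s * (+ m * + g))) (sym t²≡1) ⟩
    t * t * (s * (+ m * + g))    ≡⟨ regroup t s (+ m) (+ g) ⟩
    t * + g * (t * (s * + m))    ∎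
    where
    regroup : ∀ t s m g → t * t * (s * (m * g)) ≡ t * g * (t * (s * m))
    regroup = solve-∀
  y≡ : y ≡ t * + g * + n
  y≡ = begin
    y                  ≡⟨ y≡t∣y∣ ⟩
    t * + ∣ y ∣        ≡⟨ cong (λ k → t * + k) ∣y∣≡ng ⟩
    t * + (n ℕ.* g)    ≡⟨ cong (t *_) (ℤ.pos-* n g) ⟩
    t * (+ n * + g)    ≡⟨ regroup t (+ n) (+ g) ⟩
    t * + g * + n      ∎
    where
    regroup : ∀ t n g → t * (n * g) ≡ t * g * n
    regroup = solve-∀

CoprimeSplitting : ℤ → ℤ → Set
CoprimeSplitting P m = Σ ℤ λ m′ → Σ ℤ λ r → Σ ℕ λ k →
  m ≡ m′ * r × Unimodular P m′ × r ∣ℤ P ^ k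

-- Repeatedly divide m by its gcd with P; the quotient shrinks until the gcd is a unit.
coprimeSplitting : ∀ P m → m ≢ 0ℤ → CoprimeSplitting P m
coprimeSplitting P m = <-rec Goal split ∣ m ∣ m refl
  where
  Goal : ℕ → Set
  Goal n = ∀ m → ∣ m ∣ ≡ n → m ≢ 0ℤ → CoprimeSplitting P m

  split : ∀ n → (∀ {n′} → n′ < n → Goal n′) → Goal n
  split _ rec m refl m≢0 = fromFactorisation (gcdFactorisation m P)
    where
    unitCase : ∀ h b c → h * h ≡ 1ℤ → m ≡ h * b → P ≡ h * + c →
      Unimodular b (+ c) → CoprimeSplitting P m
    unitCase h b c h²≡1 m≡hb P≡hc uni =
      m , 1ℤ , 0 , sym (ℤ.*-identityʳ m) ,
      subst₂ Unimodular (sym P≡hc) (sym m≡hb)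
        (unimodular-unitˡ {h} h²≡1 (unimodular-sym (unimodular-unitˡ {h} h²≡1 uni))) ,
      ℤ∣.∣-refl

    descend : ∀ h b → 1 < ∣ h ∣ → m ≡ h * b → h ∣ℤ P → CoprimeSplitting P m
    descend h b 1<∣h∣ m≡hb h∣P with rec ∣b∣<∣m∣ b refl b≢0
      where
      b≢0 : b ≢ 0ℤ
      b≢0 b≡0 = m≢0 (trans m≡hb (trans (cong (h *_) b≡0) (ℤ.*-zeroʳ h)))
      instance _ = ℕ.≢-nonZero (b≢0 ∘ ℤ.∣i∣≡0⇒i≡0)
      ∣b∣<∣m∣ : ∣ b ∣ < ∣ m ∣
      ∣b∣<∣m∣ = subst (∣ b ∣ <_)
        (trans (ℕ.*-comm ∣ b ∣ ∣ h ∣) (trans (sym (ℤ.abs-* h b)) (cong ∣_∣ (sym m≡hb))))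
        (ℕ.m<m*n ∣ b ∣ ∣ h ∣ 1<∣h∣)
    ... | m′ , r , k , b≡m′r , uni , r∣Pᵏ =
      m′ , h * r , ℕ.suc k ,
      trans m≡hb (trans (cong (h *_) b≡m′r) (regroup h m′ r)) , uni ,
      ℤ∣.∣-trans (ℤ∣.*-monoˡ-∣ r h∣P) (ℤ∣.*-monoʳ-∣ P r∣Pᵏ)
      where
      regroup : ∀ h m′ r → h * (m′ * r) ≡ m′ * (h * r)
      regroup = solve-∀

    fromFactorisation : GcdFactorisation m P → CoprimeSplitting P m
    fromFactorisation (+0 , b , c , m≡0b , _) = ⊥-elim (m≢0 m≡0b)
    fromFactorisation (h@(+[1+ 0 ]) , b , c , m≡hb , P≡hc , uni) = unitCase h b c refl m≡hb P≡hc uni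
    fromFactorisation (h@(-[1+ 0 ]) , b , c , m≡hb , P≡hc , uni) = unitCase h b c refl m≡hb P≡hc uni
    fromFactorisation (h@(+[1+ ℕ.suc _ ]) , b , c , m≡hb , P≡hc , _) =
      descend h b (ℕ.s≤s (ℕ.s≤s ℕ.z≤n)) m≡hb (divides (+ c) (trans P≡hc (ℤ.*-comm h (+ c))))
    fromFactorisation (h@(-[1+ ℕ.suc _ ]) , b , c , m≡hb , P≡hc , _) =
      descend h b (ℕ.s≤s (ℕ.s≤s ℕ.z≤n)) m≡hb (divides (+ c) (trans P≡hc (ℤ.*-comm h (+ c))))

-- With m = m′ r split as above, P + d m′ is prime to m′ (≡ P mod m′) and to P (as d m′ is),
-- hence to r ∣ Pᵏ.
unimodular-shift : ∀ {P d} m → m ≢ 0ℤ → Unimodular P d → Σ ℤ λ t → Unimodular (P + d * t) m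
unimodular-shift {P} {d} m m≢0 P⊥d = shiftBy (coprimeSplitting P m m≢0)
  where
  shiftBy : CoprimeSplitting P m → Σ ℤ λ t → Unimodular (P + d * t) m
  shiftBy (m′ , r , k , m≡m′r , P⊥m′ , r∣Pᵏ) =
    m′ , subst (Unimodular u) (sym m≡m′r) (unimodular-*ʳ u⊥m′ u⊥r)
    where
    u : ℤ
    u = P + d * m′
    u⊥m′ : Unimodular u m′
    u⊥m′ = unimodular-+* d P⊥m′
    reorder : ∀ d m′ P → d * m′ + 1ℤ * P ≡ P + d * m′
    reorder = solve-∀
    u⊥P : Unimodular u P
    u⊥P = subst (λ a → Unimodular a P) (reorder d m′ P)
      (unimodular-+* 1ℤ (unimodular-sym (unimodular-*ʳ P⊥d P⊥m′)))
    u⊥r : Unimodular u r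
    u⊥r = unimodular-∣ʳ (unimodular-^ʳ u⊥P k) r∣Pᵏ

-- Integer matrices and Γ₀(N)

Vec3ℤ : Set
Vec3ℤ = Fin 3 → ℤ

vec3 : ℤ → ℤ → ℤ → Vec3ℤ
vec3 a b c zero             = a
vec3 a b c (suc zero)       = b
vec3 a b c (suc (suc zero)) = c

mat3 : ℤ → ℤ → ℤ → ℤ → ℤ → ℤ → ℤ → ℤ → ℤ → Mat3ℤ
mat3 a b c d e f g h i = λ where
  zero             → vec3 a b c
  (suc zero)       → vec3 d e f
  (suc (suc zero)) → vec3 g h i

actℤ : Mat3ℤ → Vec3ℤ → Vec3ℤ
actℤ M x i = M i i0 * x i0 + M i i1 * x i1 + M i i2 * x i2

_*ᴹ_ : Mat3ℤ → Mat3ℤ → Mat3ℤ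
(A *ᴹ B) i j = A i i0 * B i0 j + A i i1 * B i1 j + A i i2 * B i2 j

adj : Mat3ℤ → Mat3ℤ
adj M = mat3
  (e * i - f * h) (c * h - b * i) (b * f - c * e)
  (f * g - d * i) (a * i - c * g) (c * d - a * f)
  (d * h - e * g) (b * g - a * h) (a * e - b * d)
  where
  a b c d e f g h i : ℤ
  a = M i0 i0; b = M i0 i1; c = M i0 i2
  d = M i1 i0; e = M i1 i1; f = M i1 i2
  g = M i2 i0; h = M i2 i1; i = M i2 i2

det3-*ᴹ : ∀ A B → det3 (A *ᴹ B) ≡ det3 A * det3 B
det3-*ᴹ A B = expand
  (A i0 i0) (A i0 i1) (A i0 i2) (A i1 i0) (A i1 i1) (A i1 i2) (A i2 i0) (A i2 i1) (A i2 i2)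
  (B i0 i0) (B i0 i1) (B i0 i2) (B i1 i0) (B i1 i1) (B i1 i2) (B i2 i0) (B i2 i1) (B i2 i2)
  where
  expand : ∀ a b c d e f g h i a′ b′ c′ d′ e′ f′ g′ h′ i′ →
    let det : ℤ → ℤ → ℤ → ℤ → ℤ → ℤ → ℤ → ℤ → ℤ → ℤ
        det a b c d e f g h i = a * (e * i - f * h) - b * (d * i - f * g) + c * (d * h - e * g)
    in det (a * a′ + b * d′ + c * g′) (a * b′ + b * e′ + c * h′) (a * c′ + b * f′ + c * i′)
           (d * a′ + e * d′ + f * g′) (d * b′ + e * e′ + f * h′) (d * c′ + e * f′ + f * i′)
           (g * a′ + h * d′ + i * g′) (g * b′ + h * e′ + i * h′) (g * c′ + h * f′ + i * i′)
       ≡ det a b c d e f g h i * det a′ b′ c′ d′ e′ f′ g′ h′ i′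
  expand = solve-∀

det3-adj : ∀ M → det3 (adj M) ≡ det3 M * det3 M
det3-adj M =
  expand (M i0 i0) (M i0 i1) (M i0 i2) (M i1 i0) (M i1 i1) (M i1 i2) (M i2 i0) (M i2 i1) (M i2 i2)
  where
  expand : ∀ a b c d e f g h i →
    let det : ℤ → ℤ → ℤ → ℤ → ℤ → ℤ → ℤ → ℤ → ℤ → ℤ
        det a b c d e f g h i = a * (e * i - f * h) - b * (d * i - f * g) + c * (d * h - e * g)
    in det (e * i - f * h) (c * h - b * i) (b * f - c * e)
           (f * g - d * i) (a * i - c * g) (c * d - a * f)
           (d * h - e * g) (b * g - a * h) (a * e - b * d)
       ≡ det a b c d e f g h i * det a b c d e f g h i
  expand = solve-∀

actℤ-*ᴹ : ∀ A B x i → actℤ (A *ᴹ B) x i ≡ actℤ A (actℤ B x) i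
actℤ-*ᴹ A B x i = expand (A i i0) (A i i1) (A i i2)
  (B i0 i0) (B i0 i1) (B i0 i2) (B i1 i0) (B i1 i1) (B i1 i2) (B i2 i0) (B i2 i1) (B i2 i2)
  (x i0) (x i1) (x i2)
  where
  expand : ∀ a₀ a₁ a₂ b₀ b₁ b₂ b₃ b₄ b₅ b₆ b₇ b₈ x₀ x₁ x₂ →
    (a₀ * b₀ + a₁ * b₃ + a₂ * b₆) * x₀ + (a₀ * b₁ + a₁ * b₄ + a₂ * b₇) * x₁
      + (a₀ * b₂ + a₁ * b₅ + a₂ * b₈) * x₂
    ≡ a₀ * (b₀ * x₀ + b₁ * x₁ + b₂ * x₂) + a₁ * (b₃ * x₀ + b₄ * x₁ + b₅ * x₂)
      + a₂ * (b₆ * x₀ + b₇ * x₁ + b₈ * x₂)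
  expand = solve-∀

actℤ-adj : ∀ M x i → actℤ (adj M) (actℤ M x) i ≡ det3 M * x i
actℤ-adj M x zero = expand₀
  (M i0 i0) (M i0 i1) (M i0 i2) (M i1 i0) (M i1 i1) (M i1 i2) (M i2 i0) (M i2 i1) (M i2 i2)
  (x i0) (x i1) (x i2)
  where
  expand₀ : ∀ a b c d e f g h i x₀ x₁ x₂ →
    (e * i - f * h) * (a * x₀ + b * x₁ + c * x₂) + (c * h - b * i) * (d * x₀ + e * x₁ + f * x₂)
      + (b * f - c * e) * (g * x₀ + h * x₁ + i * x₂)
    ≡ (a * (e * i - f * h) - b * (d * i - f * g) + c * (d * h - e * g)) * x₀
  expand₀ = solve-∀
actℤ-adj M x (suc zero) = expand₁
  (M i0 i0) (M i0 i1) (M i0 i2) (M i1 i0) (M i1 i1) (M i1 i2) (M i2 i0) (M i2 i1) (M i2 i2)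
  (x i0) (x i1) (x i2)
  where
  expand₁ : ∀ a b c d e f g h i x₀ x₁ x₂ →
    (f * g - d * i) * (a * x₀ + b * x₁ + c * x₂) + (a * i - c * g) * (d * x₀ + e * x₁ + f * x₂)
      + (c * d - a * f) * (g * x₀ + h * x₁ + i * x₂)
    ≡ (a * (e * i - f * h) - b * (d * i - f * g) + c * (d * h - e * g)) * x₁
  expand₁ = solve-∀
actℤ-adj M x (suc (suc zero)) = expand₂
  (M i0 i0) (M i0 i1) (M i0 i2) (M i1 i0) (M i1 i1) (M i1 i2) (M i2 i0) (M i2 i1) (M i2 i2)
  (x i0) (x i1) (x i2)
  where
  expand₂ : ∀ a b c d e f g h i x₀ x₁ x₂ →
    (d * h - e * g) * (a * x₀ + b * x₁ + c * x₂) + (b * g - a * h) * (d * x₀ + e * x₁ + f * x₂)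
      + (a * e - b * d) * (g * x₀ + h * x₁ + i * x₂)
    ≡ (a * (e * i - f * h) - b * (d * i - f * g) + c * (d * h - e * g)) * x₂
  expand₂ = solve-∀

actℤ-cong : ∀ M {x y} → (∀ j → x j ≡ y j) → ∀ i → actℤ M x i ≡ actℤ M y i
actℤ-cong M x≡y i =
  cong₂ _+_ (cong₂ _+_ (cong (M i i0 *_) (x≡y i0)) (cong (M i i1 *_) (x≡y i1)))
            (cong (M i i2 *_) (x≡y i2))

actℤ-scale : ∀ M t x i → actℤ M (λ j → t * x j) i ≡ t * actℤ M x i
actℤ-scale M t x i = expand (M i i0) (M i i1) (M i i2) t (x i0) (x i1) (x i2)
  where
  expand : ∀ a b c t x y z → a * (t * x) + b * (t * y) + c * (t * z) ≡ t * (a * x + b * y + c * z)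
  expand = solve-∀

mkInΓ₀ : ∀ {N} γ → det3 γ ≡ 1ℤ → + N ∣ℤ γ i1 i0 → + N ∣ℤ γ i2 i0 → InΓ₀ N γ
mkInΓ₀ _ det≡1 N∣γ₁₀ N∣γ₂₀ = det≡1 , ∣⇒∣ᵤ N∣γ₁₀ , ∣⇒∣ᵤ N∣γ₂₀

∣-firstColumn-*ᴹ : ∀ {n} A B i → n ∣ℤ A i i0 → n ∣ℤ B i1 i0 → n ∣ℤ B i2 i0 → n ∣ℤ (A *ᴹ B) i i0
∣-firstColumn-*ᴹ A B i n∣a n∣b₁ n∣b₂ = ℤ∣.∣m∣n⇒∣m+n
  (ℤ∣.∣m∣n⇒∣m+n (ℤ∣.∣m⇒∣m*n (B i0 i0) n∣a) (ℤ∣.∣n⇒∣m*n (A i i1) n∣b₁))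
  (ℤ∣.∣n⇒∣m*n (A i i2) n∣b₂)

InΓ₀-*ᴹ : ∀ {N A B} → InΓ₀ N A → InΓ₀ N B → InΓ₀ N (A *ᴹ B)
InΓ₀-*ᴹ {N} {A} {B} (detA , a₁ , a₂) (detB , b₁ , b₂) = mkInΓ₀ (A *ᴹ B)
  (trans (det3-*ᴹ A B) (cong₂ _*_ detA detB))
  (∣-firstColumn-*ᴹ A B i1 (∣ᵤ⇒∣ a₁) (∣ᵤ⇒∣ b₁) (∣ᵤ⇒∣ b₂))
  (∣-firstColumn-*ᴹ A B i2 (∣ᵤ⇒∣ a₂) (∣ᵤ⇒∣ b₁) (∣ᵤ⇒∣ b₂))

InΓ₀-adj : ∀ {N γ} → InΓ₀ N γ → InΓ₀ N (adj γ)
InΓ₀-adj {N} {γ} (det≡1 , n₁ , n₂) = mkInΓ₀ (adj γ)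
  (trans (det3-adj γ) (cong₂ _*_ det≡1 det≡1))
  (ℤ∣.∣m∣n⇒∣m-n (ℤ∣.∣n⇒∣m*n (γ i1 i2) N∣γ₂₀) (ℤ∣.∣m⇒∣m*n (γ i2 i2) N∣γ₁₀))
  (ℤ∣.∣m∣n⇒∣m-n (ℤ∣.∣m⇒∣m*n (γ i2 i1) N∣γ₁₀) (ℤ∣.∣n⇒∣m*n (γ i1 i1) N∣γ₂₀))
  where
  N∣γ₁₀ : + N ∣ℤ γ i1 i0
  N∣γ₁₀ = ∣ᵤ⇒∣ n₁
  N∣γ₂₀ : + N ∣ℤ γ i2 i0
  N∣γ₂₀ = ∣ᵤ⇒∣ n₂

-- Orbits of integer vectors

infix 4 _∼[_]_
record _∼[_]_ (x : Vec3ℤ) (N : ℕ) (y : Vec3ℤ) : Set where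
  constructor related
  field
    γ    : Mat3ℤ
    γ∈Γ₀ : InΓ₀ N γ
    γx≡y : ∀ i → actℤ γ x i ≡ y i

∼-trans : ∀ {N x y z} → x ∼[ N ] y → y ∼[ N ] z → x ∼[ N ] z
∼-trans {x = x} (related γ γ∈Γ₀ γx≡y) (related δ δ∈Γ₀ δy≡z) =
  related (δ *ᴹ γ) (InΓ₀-*ᴹ {A = δ} {B = γ} δ∈Γ₀ γ∈Γ₀)
  λ i → trans (actℤ-*ᴹ δ γ x i) (trans (actℤ-cong δ γx≡y i) (δy≡z i))

∼-sym : ∀ {N x y} → x ∼[ N ] y → y ∼[ N ] x
∼-sym {x = x} (related γ γ∈Γ₀@(det≡1 , _) γx≡y) =
  related (adj γ) (InΓ₀-adj {γ = γ} γ∈Γ₀)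
  λ i → trans (sym (actℤ-cong (adj γ) γx≡y i))
   (trans (actℤ-adj γ x i) (trans (cong (_* x i) det≡1) (ℤ.*-identityˡ (x i))))

∼-η : ∀ {N x y} → vec3 (x i0) (x i1) (x i2) ∼[ N ] y → x ∼[ N ] y
∼-η (related γ γ∈Γ₀ γx≡y) = related γ γ∈Γ₀ γx≡y

∼-zero : ∀ {N x y} → x ∼[ N ] y → (∀ i → y i ≡ 0ℤ) → ∀ i → x i ≡ 0ℤ
∼-zero {N} {x} {y} x∼y y≡0 = vanish (∼-sym x∼y)
  where
  annihilate : ∀ a b c → a * 0ℤ + b * 0ℤ + c * 0ℤ ≡ 0ℤ
  annihilate = solve-∀
  vanish : y ∼[ N ] x → ∀ i → x i ≡ 0ℤ
  vanish (related δ _ δy≡x) i =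
    trans (sym (δy≡x i)) (trans (actℤ-cong δ y≡0 i) (annihilate (δ i i0) (δ i i1) (δ i i2)))

_•_ : ℤ → Vec3ℤ → Vec3ℤ
(s • x) i = s * x i

e1d0ℤ : ℕ → Vec3ℤ
e1d0ℤ d = vec3 1ℤ (+ d) 0ℤ

∣0ℤ : ∀ n → n ∣ℤ 0ℤ
∣0ℤ n = divides 0ℤ (sym (ℤ.*-zeroˡ n))

clearThirdMove : ∀ N x₀ h b c → Unimodular b c → vec3 x₀ (h * b) (h * c) ∼[ N ] vec3 x₀ h 0ℤ
clearThirdMove N x₀ h b c (p , q , pb+qc≡1) =
  related γ (mkInΓ₀ γ (trans (det≡ p q b c) pb+qc≡1) (∣0ℤ (+ N)) (∣0ℤ (+ N))) action
  where
  γ : Mat3ℤ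
  γ = mat3 1ℤ 0ℤ 0ℤ 0ℤ p q 0ℤ (- c) b
  det≡ : ∀ p q b c →
    1ℤ * (p * b - q * - c) - 0ℤ * (0ℤ * b - q * 0ℤ) + 0ℤ * (0ℤ * - c - p * 0ℤ) ≡ p * b + q * c
  det≡ = solve-∀
  row₀ : ∀ x₀ y z → 1ℤ * x₀ + 0ℤ * y + 0ℤ * z ≡ x₀
  row₀ = solve-∀
  row₁ : ∀ x₀ h b c p q → 0ℤ * x₀ + p * (h * b) + q * (h * c) ≡ h * (p * b + q * c)
  row₁ = solve-∀
  row₂ : ∀ x₀ h b c → 0ℤ * x₀ + - c * (h * b) + b * (h * c) ≡ 0ℤ
  row₂ = solve-∀
  action : ∀ i → actℤ γ (vec3 x₀ (h * b) (h * c)) i ≡ vec3 x₀ h 0ℤ i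
  action zero             = row₀ x₀ (h * b) (h * c)
  action (suc zero)       =
    trans (row₁ x₀ h b c p q) (trans (cong (h *_) pb+qc≡1) (ℤ.*-identityʳ h))
  action (suc (suc zero)) = row₂ x₀ h b c

addThirdMove : ∀ N x₀ y → vec3 x₀ y 0ℤ ∼[ N ] vec3 x₀ y (+ N * x₀)
addThirdMove N x₀ y = related γ (mkInΓ₀ γ (det≡1 (+ N)) (∣0ℤ (+ N)) ℤ∣.∣-refl) action
  where
  γ : Mat3ℤ
  γ = mat3 1ℤ 0ℤ 0ℤ 0ℤ 1ℤ 0ℤ (+ N) 0ℤ 1ℤ
  det≡1 : ∀ n → 1ℤ * (1ℤ * 1ℤ - 0ℤ * 0ℤ) - 0ℤ * (0ℤ * 1ℤ - 0ℤ * n) + 0ℤ * (0ℤ * 0ℤ - 1ℤ * n) ≡ 1ℤ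
  det≡1 = solve-∀
  row₀ : ∀ x₀ y → 1ℤ * x₀ + 0ℤ * y + 0ℤ * 0ℤ ≡ x₀
  row₀ = solve-∀
  row₁ : ∀ x₀ y → 0ℤ * x₀ + 1ℤ * y + 0ℤ * 0ℤ ≡ y
  row₁ = solve-∀
  row₂ : ∀ n x₀ y → n * x₀ + 0ℤ * y + 1ℤ * 0ℤ ≡ n * x₀
  row₂ = solve-∀
  action : ∀ i → actℤ γ (vec3 x₀ y 0ℤ) i ≡ vec3 x₀ y (+ N * x₀) i
  action zero             = row₀ x₀ y
  action (suc zero)       = row₁ x₀ y
  action (suc (suc zero)) = row₂ (+ N) x₀ y

-- The third row (β N d, -β N a, α) kills (a, d, 0) and has first entry in N ℤ; the determinant is
-- then α u + β N, which is why u ≡ P (mod d) is shifted to be prime to N.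
normalFormMove : ∀ N g a d → N ≢ 0 → Unimodular a (+ d) →
  vec3 (g * a) (g * + d) 0ℤ ∼[ N ] g • e1d0ℤ d
normalFormMove N g a d N≢0 (P , Q , Pa+Qd≡1) =
  fromShift (unimodular-shift (+ N) (N≢0 ∘ ℤ.+-injective)
               (a , Q , trans (cong (λ x → x + Q * + d) (ℤ.*-comm a P)) Pa+Qd≡1))
  where
  fromShift : Σ ℤ (λ t → Unimodular (P + + d * t) (+ N)) →
    vec3 (g * a) (g * + d) 0ℤ ∼[ N ] g • e1d0ℤ d
  fromShift (t , α , β , αu+βN≡1) =
    related γ (mkInΓ₀ γ det≡1 (∣0ℤ (+ N)) (ℤ∣.∣m⇒∣m*n (+ d) (ℤ∣.∣n⇒∣m*n β ℤ∣.∣-refl))) action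
    where
    open ≡-Reasoning
    u q : ℤ
    u = P + + d * t
    q = Q - t * a
    γ : Mat3ℤ
    γ = mat3 u q 0ℤ 0ℤ 1ℤ 1ℤ (β * + N * + d) (- (β * + N * a)) α

    ua+qd≡1 : u * a + q * + d ≡ 1ℤ
    ua+qd≡1 = trans (shift P Q a (+ d) t) Pa+Qd≡1
      where
      shift : ∀ P Q a d t → (P + d * t) * a + (Q - t * a) * d ≡ P * a + Q * d
      shift = solve-∀

    det≡1 : det3 γ ≡ 1ℤ
    det≡1 = begin
      det3 γ                                  ≡⟨ expand u q a (+ d) α β (+ N) ⟩
      α * u + β * + N * (u * a + q * + d)     ≡⟨ cong (λ x → α * u + β * + N * x) ua+qd≡1 ⟩
      α * u + β * + N * 1ℤ                    ≡⟨ cong (λ x → α * u + x) (ℤ.*-identityʳ (β * + N)) ⟩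
      α * u + β * + N                         ≡⟨ αu+βN≡1 ⟩
      1ℤ                                      ∎
      where
      expand : ∀ u q a d α β n →
        u * (1ℤ * α - 1ℤ * - (β * n * a)) - q * (0ℤ * α - 1ℤ * (β * n * d))
          + 0ℤ * (0ℤ * - (β * n * a) - 1ℤ * (β * n * d))
        ≡ α * u + β * n * (u * a + q * d)
      expand = solve-∀

    row₀ : ∀ u q g a d → u * (g * a) + q * (g * d) + 0ℤ * 0ℤ ≡ g * (u * a + q * d)
    row₀ = solve-∀
    row₁ : ∀ g a d → 0ℤ * (g * a) + 1ℤ * (g * d) + 1ℤ * 0ℤ ≡ g * d
    row₁ = solve-∀
    row₂ : ∀ β n d a g α → β * n * d * (g * a) + - (β * n * a) * (g * d) + α * 0ℤ ≡ g * 0ℤ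
    row₂ = solve-∀
    action : ∀ i → actℤ γ (vec3 (g * a) (g * + d) 0ℤ) i ≡ (g • e1d0ℤ d) i
    action zero             = trans (row₀ u q g a (+ d)) (cong (g *_) ua+qd≡1)
    action (suc zero)       = row₁ g a (+ d)
    action (suc (suc zero)) = row₂ β (+ N) (+ d) a g α

clearThird : ∀ N x₀ y z → Σ ℤ λ h → h ∣ℤ z × vec3 x₀ y z ∼[ N ] vec3 x₀ h 0ℤ
clearThird N x₀ y z = fromFactorisation (gcdFactorisation y z)
  where
  fromFactorisation : GcdFactorisation y z → Σ ℤ λ h → h ∣ℤ z × vec3 x₀ y z ∼[ N ] vec3 x₀ h 0ℤ
  fromFactorisation (h , b , c , y≡hb , z≡hc , b⊥c) =
    h , divides (+ c) (trans z≡hc (ℤ.*-comm h (+ c))) ,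
    subst₂ (λ y z → vec3 x₀ y z ∼[ N ] vec3 x₀ h 0ℤ) (sym y≡hb) (sym z≡hc)
      (clearThirdMove N x₀ h b (+ c) b⊥c)

reduceToPlane : ∀ N x → Σ ℤ λ k → k ∣ℤ + N * x i0 × x ∼[ N ] vec3 (x i0) k 0ℤ
reduceToPlane N x = clearAgain (clearThird N (x i0) (x i1) (x i2))
  where
  clearAgain : Σ ℤ (λ h → h ∣ℤ x i2 × vec3 (x i0) (x i1) (x i2) ∼[ N ] vec3 (x i0) h 0ℤ) →
    Σ ℤ λ k → k ∣ℤ + N * x i0 × x ∼[ N ] vec3 (x i0) k 0ℤ
  clearAgain (h , _ , x∼x₀h0) =
    let (k , k∣Nx₀ , x₀hNx₀∼x₀k0) = clearThird N (x i0) h (+ N * x i0)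
    in k , k∣Nx₀ ,
       ∼-trans (∼-η x∼x₀h0)
         (∼-trans (addThirdMove N (x i0) h) x₀hNx₀∼x₀k0)

HasNormalForm : ℕ → Vec3ℤ → Set
HasNormalForm N x = Σ ℕ λ d → d ∣ N × Σ ℤ λ s → s ≢ 0ℤ × x ∼[ N ] s • e1d0ℤ d

-- Writing x₀ = g a and k = g d with a, d coprime, k ∣ N x₀ gives d ∣ N a, hence d ∣ N.
planeNormalForm : ∀ N → N ≢ 0 → ∀ {x} → ¬ (∀ i → x i ≡ 0ℤ) → ∀ x₀ k → k ∣ℤ + N * x₀ →
  x ∼[ N ] vec3 x₀ k 0ℤ → HasNormalForm N x
planeNormalForm N N≢0 {x} x≢0 x₀ k k∣Nx₀ x∼x₀k0 = fromFactorisation (gcdFactorisation x₀ k)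
  where
  fromFactorisation : GcdFactorisation x₀ k → HasNormalForm N x
  fromFactorisation (g , a , d , x₀≡ga , k≡gd , a⊥d) =
    d , d∣N , g , g≢0 ,
    ∼-trans x∼x₀k0 (subst₂ (λ x₀ k → vec3 x₀ k 0ℤ ∼[ N ] g • e1d0ℤ d) (sym x₀≡ga) (sym k≡gd)
                            (normalFormMove N g a d N≢0 a⊥d))
    where
    g≢0 : g ≢ 0ℤ
    g≢0 g≡0 = x≢0 (∼-zero x∼x₀k0 vanishes)
      where
      vanishes : ∀ i → vec3 x₀ k 0ℤ i ≡ 0ℤ
      vanishes zero             = trans x₀≡ga (trans (cong (_* a) g≡0) (ℤ.*-zeroˡ a))
      vanishes (suc zero)       = trans k≡gd (trans (cong (_* + d) g≡0) (ℤ.*-zeroˡ (+ d)))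
      vanishes (suc (suc zero)) = refl

    d∣N : d ∣ N
    d∣N = ∣⇒∣ᵤ (unimodular-divisor (+ N) a⊥d d∣Na)
      where
      instance _ = ℤ.≢-nonZero g≢0
      regroup : ∀ n g a → n * (g * a) ≡ g * (n * a)
      regroup = solve-∀
      d∣Na : + d ∣ℤ + N * a
      d∣Na = ℤ∣.*-cancelˡ-∣ g
        (subst₂ _∣ℤ_ k≡gd (trans (cong (+ N *_) x₀≡ga) (regroup (+ N) g a)) k∣Nx₀)

orbit-normalForm : ∀ N → N ≢ 0 → ∀ x → ¬ (∀ i → x i ≡ 0ℤ) → HasNormalForm N x
orbit-normalForm N N≢0 x x≢0 =
  let (k , k∣Nx₀ , x∼x₀k0) = reduceToPlane N x
  in planeNormalForm N N≢0 x≢0 (x i0) k k∣Nx₀ x∼x₀k0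

representative-divides : ∀ {N d d′ s s′} → d ∣ N → s ≢ 0ℤ →
  s • e1d0ℤ d ∼[ N ] s′ • e1d0ℤ d′ → Σ ℤ λ u → s′ ≡ s * u × + d ∣ℤ u * + d′
representative-divides {N} {d} {d′} {s} {s′} d∣N s≢0 (related B (_ , N∣B₁₀ , _) Bse≡s′e′) =
  v i0 , s′≡sv₀ , subst (+ d ∣ℤ_) v₁≡v₀d′ d∣v₁
  where
  instance _ = ℤ.≢-nonZero s≢0
  v : Vec3ℤ
  v = actℤ B (e1d0ℤ d)
  s′e′≡sv : ∀ i → s′ * e1d0ℤ d′ i ≡ s * v i
  s′e′≡sv i = trans (sym (Bse≡s′e′ i)) (actℤ-scale B s (e1d0ℤ d) i)
  s′≡sv₀ : s′ ≡ s * v i0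
  s′≡sv₀ = trans (sym (ℤ.*-identityʳ s′)) (s′e′≡sv i0)
  v₁≡v₀d′ : v i1 ≡ v i0 * + d′
  v₁≡v₀d′ = ℤ.*-cancelˡ-≡ s (v i1) (v i0 * + d′)
    (trans (sym (s′e′≡sv i1)) (trans (cong (_* + d′) s′≡sv₀) (ℤ.*-assoc s (v i0) (+ d′))))
  d∣v₁ : + d ∣ℤ v i1
  d∣v₁ = ℤ∣.∣m∣n⇒∣m+n
    (ℤ∣.∣m∣n⇒∣m+n (ℤ∣.∣m⇒∣m*n {m = B i1 i0} 1ℤ (ℤ∣.∣-trans {j = + N} (∣ᵤ⇒∣ d∣N) (∣ᵤ⇒∣ N∣B₁₀)))
                  (ℤ∣.∣n⇒∣m*n (B i1 i1) ℤ∣.∣-refl))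
    (ℤ∣.∣n⇒∣m*n (B i1 i2) (∣0ℤ (+ d)))

∣-unit : ∀ {m n u u′} → u′ * u ≡ 1ℤ → m ∣ℤ u * n → m ∣ℤ n
∣-unit {m} {n} {u} {u′} u′u≡1 m∣un =
  subst (m ∣ℤ_) (trans (sym (ℤ.*-assoc u′ u n)) (trans (cong (_* n) u′u≡1) (ℤ.*-identityˡ n)))
    (ℤ∣.∣n⇒∣m*n u′ m∣un)

representative-unique : ∀ {N d d′ s s′} → d ∣ N → d′ ∣ N → s ≢ 0ℤ →
  s • e1d0ℤ d ∼[ N ] s′ • e1d0ℤ d′ → d ≡ d′
representative-unique {N} {d} {d′} {s} {s′} d∣N d′∣N s≢0 se∼s′e′ =
  antisym (representative-divides d∣N s≢0 se∼s′e′)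
          (representative-divides d′∣N s′≢0 (∼-sym se∼s′e′))
  where
  s′≢0 : s′ ≢ 0ℤ
  s′≢0 s′≡0 = s≢0 (trans (sym (ℤ.*-identityʳ s))
    (∼-zero se∼s′e′ (λ i → trans (cong (_* e1d0ℤ d′ i) s′≡0) (ℤ.*-zeroˡ (e1d0ℤ d′ i))) i0))

  antisym : Σ ℤ (λ u → s′ ≡ s * u × + d ∣ℤ u * + d′) → Σ ℤ (λ u′ → s ≡ s′ * u′ × + d′ ∣ℤ u′ * + d) →
    d ≡ d′
  antisym (u , s′≡su , d∣ud′) (u′ , s≡s′u′ , d′∣u′d) =
    ℕ.∣-antisym (∣⇒∣ᵤ (∣-unit {+ d} {+ d′} {u} {u′} u′u≡1 d∣ud′))
      (∣⇒∣ᵤ (∣-unit {+ d′} {+ d} {u′} {u} uu′≡1 d′∣u′d))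
    where
    instance _ = ℤ.≢-nonZero s≢0
    regroup : ∀ s u u′ → s * (u′ * u) ≡ s * u * u′
    regroup = solve-∀
    u′u≡1 : u′ * u ≡ 1ℤ
    u′u≡1 = ℤ.*-cancelˡ-≡ s (u′ * u) 1ℤ
      (trans (regroup s u u′)
        (trans (cong (_* u′) (sym s′≡su)) (trans (sym s≡s′u′) (sym (ℤ.*-identityʳ s)))))
    uu′≡1 : u * u′ ≡ 1ℤ
    uu′≡1 = trans (ℤ.*-comm u u′) u′u≡1

-- Rational vectors

toℚᵘ-ι : ∀ a → toℚᵘ (ι a) ≃ᵘ mkℚᵘ a 0
toℚᵘ-ι a = ℚ.toℚᵘ-fromℚᵘ (mkℚᵘ a 0)

ι-+ : ∀ a b → ι (a + b) ≡ ι a ℚ.+ ι b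
ι-+ a b = ℚ.toℚᵘ-injective (begin
  toℚᵘ (ι (a + b))              ≈⟨ toℚᵘ-ι (a + b) ⟩
  mkℚᵘ (a + b) 0                ≈⟨ ℚᵘ.*≡* (expand a b) ⟩
  mkℚᵘ a 0 ℚᵘ.+ mkℚᵘ b 0        ≈⟨ ℚᵘ.+-cong (toℚᵘ-ι a) (toℚᵘ-ι b) ⟨
  toℚᵘ (ι a) ℚᵘ.+ toℚᵘ (ι b)    ≈⟨ ℚ.toℚᵘ-homo-+ (ι a) (ι b) ⟨
  toℚᵘ (ι a ℚ.+ ι b)            ∎)
  where
  open ℚᵘ.≃-Reasoning
  expand : ∀ a b → (a + b) * 1ℤ ≡ (a * 1ℤ + b * 1ℤ) * 1ℤ
  expand = solve-∀

ι-* : ∀ a b → ι (a * b) ≡ ι a ℚ.* ι b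
ι-* a b = ℚ.toℚᵘ-injective (begin
  toℚᵘ (ι (a * b))              ≈⟨ toℚᵘ-ι (a * b) ⟩
  mkℚᵘ (a * b) 0                ≈⟨ ℚᵘ.*-cong (toℚᵘ-ι a) (toℚᵘ-ι b) ⟨
  toℚᵘ (ι a) ℚᵘ.* toℚᵘ (ι b)    ≈⟨ ℚ.toℚᵘ-homo-* (ι a) (ι b) ⟨
  toℚᵘ (ι a ℚ.* ι b)            ∎)
  where open ℚᵘ.≃-Reasoning

ι-injective : ∀ {a b} → ι a ≡ ι b → a ≡ b
ι-injective {a} {b} ιa≡ιb with
  ℚᵘ.≃-trans (ℚᵘ.≃-sym (toℚᵘ-ι a)) (ℚᵘ.≃-trans (ℚ.toℚᵘ-cong ιa≡ιb) (toℚᵘ-ι b))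
... | ℚᵘ.*≡* a*1≡b*1 = trans (sym (ℤ.*-identityʳ a)) (trans a*1≡b*1 (ℤ.*-identityʳ b))

*-ι↧≡ι↥ : ∀ p → p ℚ.* ι (↧ p) ≡ ι (↥ p)
*-ι↧≡ι↥ p@(mkℚ n d-1 _) = ℚ.toℚᵘ-injective (begin
  toℚᵘ (p ℚ.* ι (↧ p))             ≈⟨ ℚ.toℚᵘ-homo-* p (ι (↧ p)) ⟩
  mkℚᵘ n d-1 ℚᵘ.* toℚᵘ (ι (↧ p))   ≈⟨ ℚᵘ.*-cong (ℚᵘ.≃-refl {mkℚᵘ n d-1}) (toℚᵘ-ι (↧ p)) ⟩
  mkℚᵘ n d-1 ℚᵘ.* mkℚᵘ (↧ p) 0     ≈⟨ ℚᵘ.*≡* cross ⟩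
  mkℚᵘ n 0                          ≈⟨ toℚᵘ-ι n ⟨
  toℚᵘ (ι n)                        ∎)
  where
  open ℚᵘ.≃-Reasoning
  cross : (n * + ℕ.suc d-1) * 1ℤ ≡ n * + (ℕ.suc d-1 ℕ.* 1)
  cross = trans (ℤ.*-identityʳ _) (cong (λ k → n * + k) (sym (ℕ.*-identityʳ (ℕ.suc d-1))))

ℚ-*-cancelˡ : ∀ {c a b} → c ≢ 0ℚ → c ℚ.* a ≡ c ℚ.* b → a ≡ b
ℚ-*-cancelˡ {c} {a} {b} c≢0 ca≡cb = begin
  a                    ≡⟨ ℚ.*-identityˡ a ⟨
  1ℚ ℚ.* a             ≡⟨ cong (ℚ._* a) (ℚ.*-inverseˡ c) ⟨
  c⁻¹ ℚ.* c ℚ.* a      ≡⟨ ℚ.*-assoc c⁻¹ c a ⟩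
  c⁻¹ ℚ.* (c ℚ.* a)    ≡⟨ cong (c⁻¹ ℚ.*_) ca≡cb ⟩
  c⁻¹ ℚ.* (c ℚ.* b)    ≡⟨ ℚ.*-assoc c⁻¹ c b ⟨
  c⁻¹ ℚ.* c ℚ.* b      ≡⟨ cong (ℚ._* b) (ℚ.*-inverseˡ c) ⟩
  1ℚ ℚ.* b             ≡⟨ ℚ.*-identityˡ b ⟩
  b                    ∎
  where
  open ≡-Reasoning
  instance _ = ℚ.≢-nonZero c≢0
  c⁻¹ : ℚ
  c⁻¹ = ℚ.1/ c

denominator : Vec3ℚ → ℤ
denominator v = ↧ (v i0) * ↧ (v i1) * ↧ (v i2)

denominator≢0 : ∀ v → denominator v ≢ 0ℤ
denominator≢0 v ()

codenominator : Vec3ℚ → Fin 3 → ℤ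
codenominator v zero             = ↧ (v i1) * ↧ (v i2)
codenominator v (suc zero)       = ↧ (v i0) * ↧ (v i2)
codenominator v (suc (suc zero)) = ↧ (v i0) * ↧ (v i1)

denominator≡ : ∀ v i → denominator v ≡ ↧ (v i) * codenominator v i
denominator≡ v zero             = ℤ.*-assoc (↧ (v i0)) (↧ (v i1)) (↧ (v i2))
denominator≡ v (suc zero)       = regroup (↧ (v i0)) (↧ (v i1)) (↧ (v i2))
  where
  regroup : ∀ a b c → a * b * c ≡ b * (a * c)
  regroup = solve-∀
denominator≡ v (suc (suc zero)) = ℤ.*-comm (↧ (v i0) * ↧ (v i1)) (↧ (v i2))

numerators : Vec3ℚ → Vec3ℤ
numerators v i = ↥ (v i) * codenominator v i

clearDenominators : ∀ v i → v i ℚ.* ι (denominator v) ≡ ι (numerators v i)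
clearDenominators v i = begin
  v i ℚ.* ι (denominator v)            ≡⟨ cong (λ D → v i ℚ.* ι D) (denominator≡ v i) ⟩
  v i ℚ.* ι (↧ (v i) * c)              ≡⟨ cong (v i ℚ.*_) (ι-* (↧ (v i)) c) ⟩
  v i ℚ.* (ι (↧ (v i)) ℚ.* ι c)        ≡⟨ ℚ.*-assoc (v i) (ι (↧ (v i))) (ι c) ⟨
  v i ℚ.* ι (↧ (v i)) ℚ.* ι c          ≡⟨ cong (ℚ._* ι c) (*-ι↧≡ι↥ (v i)) ⟩
  ι (↥ (v i)) ℚ.* ι c                  ≡⟨ ι-* (↥ (v i)) c ⟨
  ι (↥ (v i) * c)                      ∎
  where
  open ≡-Reasoning
  c : ℤ
  c = codenominator v i

act-cong : ∀ γ {v w} → (∀ j → v j ≡ w j) → ∀ i → act γ v i ≡ act γ w i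
act-cong γ v≡w i = cong₂ ℚ._+_
  (cong₂ ℚ._+_ (cong (ι (γ i i0) ℚ.*_) (v≡w i0)) (cong (ι (γ i i1) ℚ.*_) (v≡w i1)))
  (cong (ι (γ i i2) ℚ.*_) (v≡w i2))

act-ι : ∀ γ w i → act γ (ι ∘ w) i ≡ ι (actℤ γ w i)
act-ι γ w i = sym (begin
  ι (a * x + b * y + c * z)                    ≡⟨ ι-+ (a * x + b * y) (c * z) ⟩
  ι (a * x + b * y) ℚ.+ ι (c * z)              ≡⟨ cong₂ ℚ._+_ (ι-+ (a * x) (b * y)) (ι-* c z) ⟩
  ι (a * x) ℚ.+ ι (b * y) ℚ.+ ι c ℚ.* ι z
    ≡⟨ cong₂ (λ p q → p ℚ.+ q ℚ.+ ι c ℚ.* ι z) (ι-* a x) (ι-* b y) ⟩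
  ι a ℚ.* ι x ℚ.+ ι b ℚ.* ι y ℚ.+ ι c ℚ.* ι z  ∎)
  where
  open ≡-Reasoning
  a b c x y z : ℤ
  a = γ i i0; b = γ i i1; c = γ i i2
  x = w i0;   y = w i1;   z = w i2

act-*ʳ : ∀ γ v t i → act γ v i ℚ.* t ≡ act γ (λ j → v j ℚ.* t) i
act-*ʳ γ v t i = distrib (ι (γ i i0)) (ι (γ i i1)) (ι (γ i i2)) (v i0) (v i1) (v i2) t
  where
  open +-*-Solver
  distrib : ∀ a b c x y z t →
    (a ℚ.* x ℚ.+ b ℚ.* y ℚ.+ c ℚ.* z) ℚ.* t
      ≡ a ℚ.* (x ℚ.* t) ℚ.+ b ℚ.* (y ℚ.* t) ℚ.+ c ℚ.* (z ℚ.* t)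
  distrib = solve 7 (λ a b c x y z t →
    (a :* x :+ b :* y :+ c :* z) :* t := a :* (x :* t) :+ b :* (y :* t) :+ c :* (z :* t)) refl

act-clearDenominators : ∀ γ v i → act γ v i ℚ.* ι (denominator v) ≡ ι (actℤ γ (numerators v) i)
act-clearDenominators γ v i = begin
  act γ v i ℚ.* ι (denominator v)               ≡⟨ act-*ʳ γ v (ι (denominator v)) i ⟩
  act γ (λ j → v j ℚ.* ι (denominator v)) i     ≡⟨ act-cong γ (clearDenominators v) i ⟩
  act γ (ι ∘ numerators v) i                    ≡⟨ act-ι γ (numerators v) i ⟩
  ι (actℤ γ (numerators v) i)                   ∎
  where open ≡-Reasoning

numerators≢0 : ∀ v → NonZeroVec v → ¬ (∀ i → numerators v i ≡ 0ℤ)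
numerators≢0 v v≢0 w≡0 = v≢0 λ i → ℚ-*-cancelˡ (denominator≢0 v ∘ ι-injective) (begin
  ι D ℚ.* v i           ≡⟨ ℚ.*-comm (ι D) (v i) ⟩
  v i ℚ.* ι D           ≡⟨ clearDenominators v i ⟩
  ι (numerators v i)    ≡⟨ cong ι (w≡0 i) ⟩
  0ℚ                    ≡⟨ ℚ.*-zeroʳ (ι D) ⟨
  ι D ℚ.* 0ℚ            ∎)
  where
  open ≡-Reasoning
  D : ℤ
  D = denominator v

ι-e1d0ℤ : ∀ d i → ι (e1d0ℤ d i) ≡ e1d0 d i
ι-e1d0ℤ d zero             = refl
ι-e1d0ℤ d (suc zero)       = refl
ι-e1d0ℤ d (suc (suc zero)) = refl

sameLine⇒multiple : ∀ {u : Vec3ℚ} {x : Vec3ℤ} {δ : ℤ} {d : ℕ} →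
  δ ≢ 0ℤ → (∀ i → u i ℚ.* ι δ ≡ ι (x i)) → SameLine u (e1d0 d) →
  x i0 ≢ 0ℤ × (∀ i → x i ≡ x i0 * e1d0ℤ d i)
sameLine⇒multiple {u} {x} {δ} {d} δ≢0 uδ≡x (c , c≢0 , e≡cu) = x₀≢0 , x≡x₀e
  where
  open ≡-Reasoning
  scaled : ∀ i → e1d0 d i ℚ.* ι δ ≡ c ℚ.* ι (x i)
  scaled i =
    trans (cong (ℚ._* ι δ) (e≡cu i)) (trans (ℚ.*-assoc c (u i) (ι δ)) (cong (c ℚ.*_) (uδ≡x i)))

  x₀≢0 : x i0 ≢ 0ℤ
  x₀≢0 x₀≡0 = δ≢0 (ι-injective (begin
    ι δ                ≡⟨ sym (ℚ.*-identityˡ (ι δ)) ⟩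
    1ℚ ℚ.* ι δ         ≡⟨ scaled i0 ⟩
    c ℚ.* ι (x i0)     ≡⟨ cong (λ t → c ℚ.* ι t) x₀≡0 ⟩
    c ℚ.* 0ℚ           ≡⟨ ℚ.*-zeroʳ c ⟩
    0ℚ                 ∎))

  swap : ∀ a c b → a ℚ.* (c ℚ.* b) ≡ c ℚ.* (b ℚ.* a)
  swap = solve 3 (λ a c b → a :* (c :* b) := c :* (b :* a)) refl
    where open +-*-Solver

  x≡x₀e : ∀ i → x i ≡ x i0 * e1d0ℤ d i
  x≡x₀e i = ι-injective (ℚ-*-cancelˡ c≢0 (begin
    c ℚ.* ι (x i)                           ≡⟨ sym (scaled i) ⟩
    e1d0 d i ℚ.* ι δ                        ≡⟨ cong (ℚ._* ι δ) (sym (ι-e1d0ℤ d i)) ⟩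
    ι (e1d0ℤ d i) ℚ.* ι δ                   ≡⟨ cong (ι (e1d0ℤ d i) ℚ.*_) (ℚ.*-identityˡ (ι δ)) ⟨
    ι (e1d0ℤ d i) ℚ.* (1ℚ ℚ.* ι δ)          ≡⟨ cong (ι (e1d0ℤ d i) ℚ.*_) (scaled i0) ⟩
    ι (e1d0ℤ d i) ℚ.* (c ℚ.* ι (x i0))      ≡⟨ swap (ι (e1d0ℤ d i)) c (ι (x i0)) ⟩
    c ℚ.* (ι (x i0) ℚ.* ι (e1d0ℤ d i))      ≡⟨ cong (c ℚ.*_) (sym (ι-* (x i0) (e1d0ℤ d i))) ⟩
    c ℚ.* ι (x i0 * e1d0ℤ d i)              ∎))

multiple⇒sameLine : ∀ {u : Vec3ℚ} {x : Vec3ℤ} {δ s : ℤ} {d : ℕ} →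
  s ≢ 0ℤ → (∀ i → u i ℚ.* ι δ ≡ ι (x i)) → (∀ i → x i ≡ s * e1d0ℤ d i) → SameLine u (e1d0 d)
multiple⇒sameLine {u} {x} {δ} {s} {d} s≢0 uδ≡x x≡se = c , c≢0 , λ i → sym (cu≡e i)
  where
  open ≡-Reasoning
  instance _ = ℚ.≢-nonZero (s≢0 ∘ ι-injective)
  s⁻¹ c : ℚ
  s⁻¹ = ℚ.1/ ι s
  c = ι δ ℚ.* s⁻¹

  regroup : ∀ δ s⁻¹ u → δ ℚ.* s⁻¹ ℚ.* u ≡ s⁻¹ ℚ.* (u ℚ.* δ)
  regroup = solve 3 (λ δ s⁻¹ u → δ :* s⁻¹ :* u := s⁻¹ :* (u :* δ)) refl
    where open +-*-Solver

  cu≡e : ∀ i → c ℚ.* u i ≡ e1d0 d i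
  cu≡e i = begin
    c ℚ.* u i                          ≡⟨ regroup (ι δ) s⁻¹ (u i) ⟩
    s⁻¹ ℚ.* (u i ℚ.* ι δ)              ≡⟨ cong (s⁻¹ ℚ.*_) (trans (uδ≡x i) (cong ι (x≡se i))) ⟩
    s⁻¹ ℚ.* ι (s * e1d0ℤ d i)          ≡⟨ cong (s⁻¹ ℚ.*_) (ι-* s (e1d0ℤ d i)) ⟩
    s⁻¹ ℚ.* (ι s ℚ.* ι (e1d0ℤ d i))    ≡⟨ sym (ℚ.*-assoc s⁻¹ (ι s) _) ⟩
    s⁻¹ ℚ.* ι s ℚ.* ι (e1d0ℤ d i)      ≡⟨ cong (ℚ._* ι (e1d0ℤ d i)) (ℚ.*-inverseˡ (ι s)) ⟩
    1ℚ ℚ.* ι (e1d0ℤ d i)               ≡⟨ ℚ.*-identityˡ _ ⟩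
    ι (e1d0ℤ d i)                      ≡⟨ ι-e1d0ℤ d i ⟩
    e1d0 d i                           ∎

  c≢0 : c ≢ 0ℚ
  c≢0 c≡0 = 1≢0 (trans (sym (cu≡e i0)) (trans (cong (ℚ._* u i0) c≡0) (ℚ.*-zeroˡ (u i0))))
    where
    1≢0 : 1ℚ ≢ 0ℚ
    1≢0 ()

lemma6p2 : (N : ℕ) → 0 < N → (v : Vec3ℚ) → NonZeroVec v →
    Σ ℕ λ d → (0 < d) × (d ∣ N) × InOrbit N v d ×
      ((d′ : ℕ) → 0 < d′ → d′ ∣ N → InOrbit N v d′ → d′ ≡ d)
lemma6p2 N 0<N v v≢0 = fromNormalForm (orbit-normalForm N N≢0 w (numerators≢0 v v≢0))
  where
  N≢0 : N ≢ 0
  N≢0 = ℕ.n>0⇒n≢0 0<N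
  D : ℤ
  D = denominator v
  w : Vec3ℤ
  w = numerators v

  fromNormalForm : HasNormalForm N w → Σ ℕ λ d → (0 < d) × (d ∣ N) × InOrbit N v d ×
      ((d′ : ℕ) → 0 < d′ → d′ ∣ N → InOrbit N v d′ → d′ ≡ d)
  fromNormalForm (d , d∣N , s , s≢0 , w∼se@(related γ γ∈Γ₀ γw≡se)) =
    d , 0<d , d∣N ,
    (γ , γ∈Γ₀ , multiple⇒sameLine {δ = D} s≢0 (act-clearDenominators γ v) γw≡se) , unique
    where
    0<d : 0 < d
    0<d = ℕ.n≢0⇒n>0 λ d≡0 → N≢0 (ℕ.0∣⇒≡0 (subst (_∣ N) d≡0 d∣N))
    unique : (d′ : ℕ) → 0 < d′ → d′ ∣ N → InOrbit N v d′ → d′ ≡ d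
    unique d′ _ d′∣N (γ′ , γ′∈Γ₀ , line) =
      let (s′≢0 , γ′w≡s′e′) =
            sameLine⇒multiple {δ = D} (denominator≢0 v) (act-clearDenominators γ′ v) line
      in representative-unique {s′ = s} d′∣N d∣N s′≢0
           (∼-trans (∼-sym (related γ′ γ′∈Γ₀ γ′w≡s′e′)) w∼se)
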